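{- Let $m\geq 2$ be square-free and let $d\geq k\geq 2$ be integers. Let $f(x)=\sum_{i=k}^d a_ix^i\in\mathbb{Z}[x]$ with $a_d\neq 0$ and $\gcd(a_k,m)=1$, and suppose that $f(x)\equiv 0\pmod m$ implies $x\equiv 0\pmod m$ for $x\in\mathbb{Z}$. Then for every non-negative integer $j$ and every integer $x$, if $f(x)\equiv 0\pmod{m^j}$ then $x\equiv 0\pmod{m^{\lceil j/k\rceil}}$. -}

module Defs where

open import Data.Nat as ℕ using (ℕ; zero; suc; _∸_; _<_; _≤_)
open import Data.Nat.Primality using (Prime)
open import Data.Integer as ℤ using (ℤ; +_)
open import Data.Integer.Divisibility as ℤD using ()
open import Relation.Nullary using (¬_)

SquareFree : ℕ → Set
SquareFree m = ∀ p → Prime p → ¬ ((p ℕ.* p) Data.Nat.Divisibility.∣ m)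
  where import Data.Nat.Divisibility

-- Σ_{i=k}^{d} a_i x^i  (empty sum = 0 when d < k).
-- polySum a x k n = Σ_{i=k}^{k+n-1} a_i x^i
polySum : (ℕ → ℤ) → ℤ → ℕ → ℕ → ℤ
polySum a x k zero    = + 0
polySum a x k (suc n) = a k ℤ.* (x ℤ.^ k) ℤ.+ polySum a x (suc k) n

evalRange : (ℕ → ℤ) → ℕ → ℕ → ℤ → ℤ
evalRange a k d x = polySum a x k (suc d ∸ k)

_≡0mod_ : ℤ → ℕ → Set
x ≡0mod n = (+ n) ℤD.∣ x

-- ⌈ j / k ⌉ for k ≥ 1
-- defined for all k; ceilDiv j 0 = 0 is a junk value, only used with k ≥ 2.
ceilDiv : (j k : ℕ) → ℕ
ceilDiv j zero    = 0
ceilDiv j (suc k) = (j ℕ.+ k) ℕ./ suc k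

-- If m^t ∣ x with t ≥ 1, write x = m^t q. Every term of f(x) of degree > k is divisible by
-- m^(t(k+1)), hence by m^(tk+1), while a_k x^k = m^(tk) a_k q^k; so m^(tk+1) ∣ f(x) forces
-- m ∣ a_k q^k, then m ∣ q^k since gcd(a_k, m) = 1, and m ∣ q since m is square-free.
-- Thus m^t ∣ x lifts to m^(t+1) ∣ x whenever tk < j (for t = 0 this is the hypothesis on
-- the roots of f mod m), and these lifts reach t = ⌈j/k⌉.
module Submission where

open import Defs
open import Data.Nat as ℕ using (ℕ; _≤_; _^_; zero; suc; s≤s; z≤n)
open import Data.Nat.GCD using (gcd)
open import Data.Integer as ℤ using (ℤ; ∣_∣)
open import Relation.Binary.PropositionalEquality using (_≡_; _≢_)

open import Data.Integer.Base using (+_; ≢-nonZero)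
import Data.Integer.Properties as ZP
open import Data.Integer.Divisibility.Signed as ℤ∣ using () renaming (_∣_ to _∣ᵢ_)
import Data.Nat.Properties as NP
open import Data.Nat.DivMod using (m<n*o⇒m/o<n)
open import Data.Nat.Divisibility
  using (_∣_; divides; _∣0; ∣-trans; ∣1⇒≡1; *-pres-∣)
open import Data.Nat.GCD using (gcd[m,n]∣m; gcd[m,n]∣n; gcd-greatest)
open import Data.Nat.Coprimality using (gcd≡1⇒coprime; coprime-divisor)
import Data.Nat.Coprimality as Coprime
open import Data.Nat.Primality using (Prime; euclidsLemma; prime[2]; ¬prime[1])
open import Data.Nat.Primality.Factorisation using (factorise)
open import Data.Nat.ListAction using (product)
open import Data.List.Base using ([]; _∷_)
open import Data.List.Relation.Unary.All using (_∷_)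
open import Data.Product using (∃-syntax; _,_; _×_)
open import Data.Sum using (inj₁; inj₂)
open import Relation.Nullary using (yes; no; contradiction)
open import Relation.Binary.PropositionalEquality using (refl; sym; trans; cong; subst; subst₂)
open import Algebra.Properties.CommutativeSemigroup ZP.*-commutativeSemigroup
  using (interchange; x∙yz≈y∙xz)

∃prime∣ : ∀ n → 2 ≤ n → ∃[ p ] Prime p × p ∣ n
∃prime∣ n@(suc (suc _)) (s≤s (s≤s z≤n)) with factorise n
... | record { factors = [] ; isFactorisation = () }
... | record { factors = p ∷ ps ; isFactorisation = n≡∏ ; factorsPrime = p-prime ∷ _ } =
  p , p-prime , divides (product ps) (trans n≡∏ (NP.*-comm p (product ps)))

prime∣^⇒∣ : ∀ {p} n k → Prime p → p ∣ n ^ k → p ∣ n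
prime∣^⇒∣ n zero    p-prime p∣1 = contradiction (subst Prime (∣1⇒≡1 p∣1) p-prime) ¬prime[1]
prime∣^⇒∣ n (suc k) p-prime p∣nⁿ⁺¹ with euclidsLemma n (n ^ k) p-prime p∣nⁿ⁺¹
... | inj₁ p∣n  = p∣n
... | inj₂ p∣nᵏ = prime∣^⇒∣ n k p-prime p∣nᵏ

squareFree⇒nonZero : ∀ {m} → SquareFree m → ℕ.NonZero m
squareFree⇒nonZero {zero}  sf = contradiction (_ ∣0) (sf 2 prime[2])
squareFree⇒nonZero {suc _} _  = _

-- Write m = q · gcd m n; if q ≥ 2, a prime p ∣ q divides m, hence n, hence gcd m n, so p² ∣ m.
squareFree∧∣^⇒∣ : ∀ {m} n k → SquareFree m → m ∣ n ^ k → m ∣ n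
squareFree∧∣^⇒∣ {m} n k sf m∣nᵏ with gcd[m,n]∣m m n
... | divides zero m≡0 = contradiction m≡0 (ℕ.≢-nonZero⁻¹ m {{squareFree⇒nonZero sf}})
... | divides (suc zero) m≡1*g =
  subst (_∣ n) (sym (trans m≡1*g (NP.*-identityˡ (gcd m n)))) (gcd[m,n]∣n m n)
... | divides q@(suc (suc _)) m≡q*g with ∃prime∣ q (s≤s (s≤s z≤n))
...   | p , p-prime , p∣q =
  contradiction (subst (p ℕ.* p ∣_) (sym m≡q*g) (*-pres-∣ p∣q p∣g)) (sf p p-prime)
  where
    p∣m : p ∣ m
    p∣m = ∣-trans p∣q (divides (gcd m n) (trans m≡q*g (NP.*-comm q (gcd m n))))
    p∣g : p ∣ gcd m n
    p∣g = gcd-greatest p∣m (prime∣^⇒∣ n k p-prime (∣-trans p∣m m∣nᵏ))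

t<ceilDiv⇒t*k<j : ∀ j k t → t ℕ.< ceilDiv j k → t ℕ.* k ℕ.< j
t<ceilDiv⇒t*k<j j (suc k) t t<⌈j/k⌉ with t ℕ.* suc k ℕ.<? j
... | yes t*k<j = t*k<j
... | no  t*k≮j = contradiction (ℕ.s≤s⁻¹ (m<n*o⇒m/o<n j+k<[1+t]*k)) (NP.<⇒≱ t<⌈j/k⌉)
  where
    open NP.≤-Reasoning
    j+k<[1+t]*k : j ℕ.+ k ℕ.< suc t ℕ.* suc k
    j+k<[1+t]*k = begin-strict
      j ℕ.+ k               ≤⟨ NP.+-monoˡ-≤ k (NP.≮⇒≥ t*k≮j) ⟩
      t ℕ.* suc k ℕ.+ k     <⟨ NP.+-monoʳ-< (t ℕ.* suc k) (NP.n<1+n k) ⟩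
      t ℕ.* suc k ℕ.+ suc k ≡⟨ NP.+-comm (t ℕ.* suc k) (suc k) ⟩
      suc t ℕ.* suc k       ∎

pos-^ : ∀ m n → + (m ^ n) ≡ (+ m) ℤ.^ n
pos-^ m zero    = refl
pos-^ m (suc n) = trans (ZP.pos-* m (m ^ n)) (cong (+ m ℤ.*_) (pos-^ m n))

∣i^n∣≡∣i∣^n : ∀ i n → ∣ i ℤ.^ n ∣ ≡ ∣ i ∣ ^ n
∣i^n∣≡∣i∣^n i zero    = refl
∣i^n∣≡∣i∣^n i (suc n) = trans (ZP.abs-* i (i ℤ.^ n)) (cong (∣ i ∣ ℕ.*_) (∣i^n∣≡∣i∣^n i n))

^-distribʳ-* : ∀ i j n → (i ℤ.* j) ℤ.^ n ≡ i ℤ.^ n ℤ.* j ℤ.^ n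
^-distribʳ-* i j zero    = refl
^-distribʳ-* i j (suc n) =
  trans (cong (i ℤ.* j ℤ.*_) (^-distribʳ-* i j n)) (interchange i j (i ℤ.^ n) (j ℤ.^ n))

^-nonZero : ∀ i n .{{_ : ℤ.NonZero i}} → ℤ.NonZero (i ℤ.^ n)
^-nonZero i n = ≢-nonZero λ iⁿ≡0 → ℕ.≢-nonZero⁻¹ ∣ i ∣ (cong ∣_∣ (ZP.i^n≡0⇒i≡0 i n iⁿ≡0))

^-monoʳ-∣ : ∀ i {m n} → m ≤ n → i ℤ.^ m ∣ᵢ i ℤ.^ n
^-monoʳ-∣ i {m} m≤n with NP.m≤n⇒∃[o]m+o≡n m≤n
... | o , refl = subst (i ℤ.^ m ∣ᵢ_) (sym (ZP.^-distribˡ-+-* i m o)) (ℤ∣.∣m⇒∣m*n (i ℤ.^ o) ℤ∣.∣-refl)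

polySum-∣ : ∀ {c} a x s n → c ∣ᵢ x ℤ.^ s → c ∣ᵢ polySum a x s n
polySum-∣ {c} a x s zero    _    = ℤ∣.divides ℤ.0ℤ (sym (ZP.*-zeroˡ c))
polySum-∣     a x s (suc n) c∣xˢ =
  ℤ∣.∣m∣n⇒∣m+n (ℤ∣.∣n⇒∣m*n (a s) c∣xˢ) (polySum-∣ a x (suc s) n (ℤ∣.∣n⇒∣m*n x c∣xˢ))

evalRange≡leading+polySum : ∀ a {k d} x → k ≤ d →
  evalRange a k d x ≡ a k ℤ.* x ℤ.^ k ℤ.+ polySum a x (suc k) (d ℕ.∸ k)
evalRange≡leading+polySum a {k} x k≤d = cong (polySum a x k) (NP.+-∸-assoc 1 k≤d)

∣evalRange⇒∣leading : ∀ a {k d c} x → k ≤ d → c ∣ᵢ x ℤ.^ suc k →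
  c ∣ᵢ evalRange a k d x → c ∣ᵢ a k ℤ.* x ℤ.^ k
∣evalRange⇒∣leading a {k} {d} {c} x k≤d c∣xᵏ⁺¹ c∣f = ℤ∣.∣m+n∣n⇒∣m
  (subst (c ∣ᵢ_) (evalRange≡leading+polySum a x k≤d) c∣f)
  (polySum-∣ a x (suc k) (d ℕ.∸ k) c∣xᵏ⁺¹)

-- As M ∣ y, the modulus y^k·M divides every term of degree > k,
-- and the term of degree k is y^k · a_k q^k.
∣evalRange[y*q]⇒∣leading : ∀ a {k d M} y q .{{_ : ℤ.NonZero y}} → k ≤ d → M ∣ᵢ y →
  y ℤ.^ k ℤ.* M ∣ᵢ evalRange a k d (y ℤ.* q) → M ∣ᵢ a k ℤ.* q ℤ.^ k
∣evalRange[y*q]⇒∣leading a {k} {d} {M} y q k≤d M∣y yᵏM∣f =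
  ℤ∣.*-cancelˡ-∣ (y ℤ.^ k) {{^-nonZero y k}}
    (subst (yᵏ ℤ.* M ∣ᵢ_) leading≡ (∣evalRange⇒∣leading a (y ℤ.* q) k≤d yᵏM∣[yq]ᵏ⁺¹ yᵏM∣f))
  where
    yᵏ = y ℤ.^ k
    leading≡ : a k ℤ.* (y ℤ.* q) ℤ.^ k ≡ yᵏ ℤ.* (a k ℤ.* q ℤ.^ k)
    leading≡ = trans (cong (a k ℤ.*_) (^-distribʳ-* y q k)) (x∙yz≈y∙xz (a k) yᵏ (q ℤ.^ k))
    yᵏM∣[yq]ᵏ⁺¹ : yᵏ ℤ.* M ∣ᵢ (y ℤ.* q) ℤ.^ suc k
    yᵏM∣[yq]ᵏ⁺¹ = begin
      yᵏ ℤ.* M                        ∣⟨ ℤ∣.*-monoʳ-∣ yᵏ M∣y ⟩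
      yᵏ ℤ.* y                        ≡⟨ ZP.*-comm yᵏ y ⟩
      y ℤ.^ suc k                     ∣⟨ ℤ∣.∣m⇒∣m*n (q ℤ.^ suc k) ℤ∣.∣-refl ⟩
      y ℤ.^ suc k ℤ.* q ℤ.^ suc k     ≡⟨ ^-distribʳ-* y q (suc k) ⟨
      (y ℤ.* q) ℤ.^ suc k             ∎
      where open ℤ∣.∣-Reasoning

m^[1+t]∣x⇒m^[2+t]∣x : ∀ {m d k} a → SquareFree m → k ≤ d → gcd ∣ a k ∣ m ≡ 1 → ∀ t x →
  (+ m) ℤ.^ suc (suc t ℕ.* k) ∣ᵢ evalRange a k d x →
  (+ m) ℤ.^ suc t ∣ᵢ x → (+ m) ℤ.^ suc (suc t) ∣ᵢ x
m^[1+t]∣x⇒m^[2+t]∣x {m} {d} {k} a sf k≤d cop t x Mᵉ∣f (ℤ∣.divides q x≡q*y) =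
  subst (M ℤ.* y ∣ᵢ_) (sym x≡q*y) (ℤ∣.*-monoˡ-∣ y M∣q)
  where
    instance
      _ = squareFree⇒nonZero sf
    M = + m
    y = M ℤ.^ suc t
    yᵏM≡Mᵉ : y ℤ.^ k ℤ.* M ≡ M ℤ.^ suc (suc t ℕ.* k)
    yᵏM≡Mᵉ = trans (cong (ℤ._* M) (ZP.^-*-assoc M (suc t) k)) (ZP.*-comm _ M)
    M∣akqᵏ : M ∣ᵢ a k ℤ.* q ℤ.^ k
    M∣akqᵏ = ∣evalRange[y*q]⇒∣leading a y q {{^-nonZero M (suc t)}} k≤d
      (ℤ∣.∣m⇒∣m*n (M ℤ.^ t) ℤ∣.∣-refl)
      (subst₂ _∣ᵢ_ (sym yᵏM≡Mᵉ) (cong (evalRange a k d) (trans x≡q*y (ZP.*-comm q y))) Mᵉ∣f)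
    m∣∣ak∣*∣q∣ᵏ : m ∣ ∣ a k ∣ ℕ.* ∣ q ∣ ^ k
    m∣∣ak∣*∣q∣ᵏ = subst (m ∣_) (trans (ZP.abs-* (a k) (q ℤ.^ k)) (cong (∣ a k ∣ ℕ.*_) (∣i^n∣≡∣i∣^n q k)))
      (ℤ∣.∣⇒∣ᵤ M∣akqᵏ)
    M∣q : M ∣ᵢ q
    M∣q = ℤ∣.∣ᵤ⇒∣ (squareFree∧∣^⇒∣ ∣ q ∣ k sf
      (coprime-divisor (Coprime.sym (gcd≡1⇒coprime {∣ a k ∣} {m} cop)) m∣∣ak∣*∣q∣ᵏ))

lemma3p1 : (m d k : ℕ) → 2 ≤ m → SquareFree m → 2 ≤ k → k ≤ d →
    (a : ℕ → ℤ) → a d ≢ ℤ.0ℤ → gcd ∣ a k ∣ m ≡ 1 →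
    (∀ (x : ℤ) → evalRange a k d x ≡0mod m → x ≡0mod m) →
    ∀ (j : ℕ) (x : ℤ) → evalRange a k d x ≡0mod (m ^ j) →
    x ≡0mod (m ^ ceilDiv j k)
lemma3p1 m d k _ sf _ k≤d a _ cop root⇒m∣ j x mʲ∣f =
  subst (_∣ ∣ x ∣) (sym (cong ∣_∣ (pos-^ m (ceilDiv j k)))) (ℤ∣.∣⇒∣ᵤ (Mᵗ∣x (ceilDiv j k) NP.≤-refl))
  where
    M = + m
    Mʲ∣f : M ℤ.^ j ∣ᵢ evalRange a k d x
    Mʲ∣f = ℤ∣.∣ᵤ⇒∣ (subst (_∣ ∣ evalRange a k d x ∣) (cong ∣_∣ (pos-^ m j)) mʲ∣f)
    step : ∀ t → t ℕ.* k ℕ.< j → M ℤ.^ t ∣ᵢ x → M ℤ.^ suc t ∣ᵢ x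
    step zero    0<j     _    = subst (_∣ᵢ x) (sym (ZP.^-identityʳ M)) (ℤ∣.∣ᵤ⇒∣ (root⇒m∣ x (ℤ∣.∣⇒∣ᵤ M∣f)))
      where
        M∣f : M ∣ᵢ evalRange a k d x
        M∣f = ℤ∣.∣-trans (subst (_∣ᵢ M ℤ.^ j) (ZP.^-identityʳ M) (^-monoʳ-∣ M 0<j)) Mʲ∣f
    step (suc t) 1+t*k<j Mᵗ∣x =
      m^[1+t]∣x⇒m^[2+t]∣x a sf k≤d cop t x (ℤ∣.∣-trans (^-monoʳ-∣ M 1+t*k<j) Mʲ∣f) Mᵗ∣x
    Mᵗ∣x : ∀ t → t ≤ ceilDiv j k → M ℤ.^ t ∣ᵢ x
    Mᵗ∣x zero    _       = ℤ∣.divides x (sym (ZP.*-identityʳ x))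
    Mᵗ∣x (suc t) t<⌈j/k⌉ =
      step t (t<ceilDiv⇒t*k<j j k t t<⌈j/k⌉) (Mᵗ∣x t (NP.<⇒≤ t<⌈j/k⌉))
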